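{- Let $a,b,k,m\in\mathbb{N}$ with $a,b>1$ and $\gcd(a,b)=1$, and let $S=\langle a^k,a^{k-1}b,\dots,ab^{k-1},b^k\rangle$. If $\mathrm{H}(S)$ is equidistributed modulo $m$, then $\gcd(ab,m)=1$.
   Context: $\mathbb{N}$ denotes the positive integers and $\mathbb{N}_0$ the non-negative integers. $\langle g_0,\dots,g_k\rangle$ denotes the set of $\mathbb{N}_0$-linear combinations of $g_0,\dots,g_k$, and $\mathrm{H}(S)=\mathbb{N}_0\setminus S$ is the (finite) set of gaps of $S$. A finite set $T\subset\mathbb{Z}$ is equidistributed modulo $m$ if it has the same number of elements in each congruence class modulo $m$. -}

module Defs where

open import Data.Nat using (ℕ; zero; suc; _+_; _*_; _∸_; _^_; _<_; NonZero)
open import Data.Nat.DivMod using (_%_)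
open import Data.Fin using (Fin; toℕ)
open import Data.Vec.Functional using (foldr; map)
open import Data.List using (List; length; filter)
open import Data.List.Membership.Propositional using (_∈_)
open import Data.List.Relation.Unary.Unique.Propositional using (Unique)
open import Data.Product using (Σ; ∃; _×_)
open import Relation.Nullary using (¬_)
open import Relation.Binary.PropositionalEquality using (_≡_)
open import Data.Nat using (_≟_)

sumF : ∀ {n} → (Fin n → ℕ) → ℕ
sumF f = foldr _+_ 0 f

gen : ℕ → ℕ → (k : ℕ) → Fin (suc k) → ℕ
gen a b k i = a ^ (k ∸ toℕ i) * b ^ toℕ i

InS : ℕ → ℕ → ℕ → ℕ → Set
InS a b k n = Σ (Fin (suc k) → ℕ) λ c → n ≡ sumF (λ i → c i * gen a b k i)

Gap : ℕ → ℕ → ℕ → ℕ → Set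
Gap a b k n = ¬ InS a b k n

Enumerates : List ℕ → (ℕ → Set) → Set
Enumerates L P = Unique L × (∀ n → (n ∈ L → P n) × (P n → n ∈ L))

countMod : (m : ℕ) .{{_ : NonZero m}} → ℕ → List ℕ → ℕ
countMod m r L = length (filter (λ x → (x % m) ≟ r) L)

Equidistributed : (m : ℕ) .{{_ : NonZero m}} → List ℕ → Set
Equidistributed m L = ∀ r s → r < m → s < m → countMod m r L ≡ countMod m s L

-- Suppose d > 1 divides m and a (the case d ∣ b is symmetric).  Then d divides every generator
-- except q = b^k, and d is coprime to q, so modulo d every element of S is a multiple of q.  Take
-- s < d with s q ≡ 1 (mod d) and x = s q.  If n is a gap divisible by d, then so is n + x: a
-- representation of n + x uses q at least s times, and removing s copies represents n.  As d ∣ m,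
-- the gaps in the class of 1 − x modulo m are divisible by d, so n ↦ n + x injects them into the
-- gaps in the class of 1; that class also contains the gap 1 < x, which is not hit.
module Submission where

open import Defs
open import Data.Nat using (ℕ; zero; suc; z<s; _+_; _*_; _∸_; _^_; _≤_; _<_; z≤n; s≤s; NonZero; _≟_; _≤?_; >-nonZero; ≢-nonZero⁻¹)
open import Data.Nat.Properties hiding (_≟_)
open import Data.Nat.Divisibility
open import Data.Nat.DivMod
open import Data.Nat.GCD using (gcd; module Bézout)
open import Data.Nat.Coprimality using (Coprime; coprime-Bézout; coprime-divisor; coprime⇒gcd≡1; gcd≡1⇒coprime)
  renaming (sym to coprime-sym)
open import Data.Nat.Solver using (module +-*-Solver)
open import Data.Fin as Fin using (Fin; toℕ; fromℕ)
open import Data.Fin.Properties using (toℕ-fromℕ; toℕ-injective; toℕ≤pred[n])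
open import Data.Vec.Functional using (updateAt)
open import Data.Vec.Functional.Properties using (updateAt-updates)
open import Data.Product using (Σ; ∃-syntax; _×_; _,_; proj₁; proj₂; uncurry)
open import Data.Empty using (⊥; ⊥-elim)
open import Function using (const; _∘_)
open import Relation.Nullary using (¬_; yes; no; contradiction)
open import Relation.Binary.PropositionalEquality
open import Data.List using (List; _∷_; length; _++_; filter; map)
open import Data.List.Properties using (length-++-sucʳ; length-map)
open import Data.List.Membership.Propositional using (_∈_)
open import Data.List.Membership.Propositional.Properties using (∈-∃++; ∈-++⁻; ∈-++⁺ˡ; ∈-++⁺ʳ; ∈-filter⁺; ∈-filter⁻; ∈-map⁻)
open import Data.List.Relation.Binary.Subset.Propositional using (_⊆_)
open import Data.List.Relation.Unary.Any using (here; there)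
open import Data.List.Relation.Unary.All as All using ()
open import Data.List.Relation.Unary.AllPairs using ([]; _∷_)
open import Data.List.Relation.Unary.Unique.Propositional using (Unique)
import Data.List.Relation.Unary.Unique.Propositional.Properties as Unique
open import Data.Sum using (inj₁; inj₂)

Unique⇒length≤ : ∀ {A : Set} {xs ys : List A} → Unique xs → xs ⊆ ys → length xs ≤ length ys
Unique⇒length≤ [] _ = z≤n
Unique⇒length≤ {xs = x ∷ xs} (x∉xs ∷ unique) xs⊆ys with ∈-∃++ (xs⊆ys (here refl))
... | ys₁ , ys₂ , refl =
  subst (suc (length xs) ≤_) (sym (length-++-sucʳ ys₁ x ys₂)) (s≤s (Unique⇒length≤ unique xs⊆ys₁++ys₂))
  where
  xs⊆ys₁++ys₂ : xs ⊆ ys₁ ++ ys₂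
  xs⊆ys₁++ys₂ z∈xs with ∈-++⁻ ys₁ (xs⊆ys (there z∈xs))
  ... | inj₁ z∈ys₁          = ∈-++⁺ˡ z∈ys₁
  ... | inj₂ (here refl)    = ⊥-elim (All.lookup x∉xs z∈xs refl)
  ... | inj₂ (there z∈ys₂) = ∈-++⁺ʳ ys₁ z∈ys₂

countMod-<-translate : ∀ m .{{_ : NonZero m}} {r r′ x y} {H : List ℕ} → Unique H →
  (∀ {n} → n ∈ H → n % m ≡ r → n + x ∈ H × (n + x) % m ≡ r′) →
  y ∈ H → y % m ≡ r′ → y < x →
  countMod m r H < countMod m r′ H
countMod-<-translate m {r} {r′} {x} {y} {H} unique translate y∈H y≡r′ y<x =
  subst (λ l → suc l ≤ countMod m r′ H) (length-map (_+ x) (class r))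
        (Unique⇒length≤ image-unique image⊆class-r′)
  where
  class : ℕ → List ℕ
  class r = filter (λ n → n % m ≟ r) H

  image : List ℕ
  image = y ∷ map (_+ x) (class r)

  y∉translates : ∀ {z} → z ∈ map (_+ x) (class r) → y ≢ z
  y∉translates z∈ y≡z with ∈-map⁻ (_+ x) z∈
  ... | n , _ , refl = <⇒≢ (≤-trans y<x (m≤n+m x n)) y≡z

  image-unique : Unique image
  image-unique = All.tabulate y∉translates
               ∷ Unique.map⁺ (+-cancelʳ-≡ x _ _) (Unique.filter⁺ (λ n → n % m ≟ r) unique)

  image⊆class-r′ : image ⊆ class r′
  image⊆class-r′ (here refl) = ∈-filter⁺ (λ n → n % m ≟ r′) y∈H y≡r′
  image⊆class-r′ (there z∈) with ∈-map⁻ (_+ x) z∈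
  ... | n , n∈ , refl with ∈-filter⁻ (λ n → n % m ≟ r) n∈
  ... | n∈H , n≡r = uncurry (∈-filter⁺ (λ n → n % m ≟ r′)) (translate n∈H n≡r)

linComb : ∀ {N} → (Fin N → ℕ) → (Fin N → ℕ) → ℕ
linComb c g = sumF (λ i → c i * g i)

infix 4 _∈⟨_⟩
_∈⟨_⟩ : ∀ {N} → ℕ → (Fin N → ℕ) → Set
n ∈⟨ g ⟩ = Σ (Fin _ → ℕ) λ c → n ≡ linComb c g

sumF-∣ : ∀ {N d} (f : Fin N → ℕ) → (∀ i → d ∣ f i) → d ∣ sumF f
sumF-∣ {zero}  {d} f d∣f = d ∣0
sumF-∣ {suc N}     f d∣f = ∣m∣n⇒∣m+n (d∣f Fin.zero) (sumF-∣ (f ∘ Fin.suc) (d∣f ∘ Fin.suc))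

linComb-updateAt : ∀ {N} (c : Fin N → ℕ) j h (g : Fin N → ℕ) →
  linComb (updateAt c j h) g + c j * g j ≡ linComb c g + h (c j) * g j
linComb-updateAt {suc N} c Fin.zero h g =
  solve 3 (λ new rest old → (new :+ rest) :+ old := (old :+ rest) :+ new) refl
    (h (c Fin.zero) * g Fin.zero) (linComb (c ∘ Fin.suc) (g ∘ Fin.suc)) (c Fin.zero * g Fin.zero)
  where open +-*-Solver
linComb-updateAt {suc N} c (Fin.suc j) h g = begin
  (c₀g₀ + linComb (updateAt (c ∘ Fin.suc) j h) (g ∘ Fin.suc)) + c (Fin.suc j) * g (Fin.suc j)
    ≡⟨ +-assoc c₀g₀ _ _ ⟩
  c₀g₀ + (linComb (updateAt (c ∘ Fin.suc) j h) (g ∘ Fin.suc) + c (Fin.suc j) * g (Fin.suc j))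
    ≡⟨ cong (c₀g₀ +_) (linComb-updateAt (c ∘ Fin.suc) j h (g ∘ Fin.suc)) ⟩
  c₀g₀ + (linComb (c ∘ Fin.suc) (g ∘ Fin.suc) + h (c (Fin.suc j)) * g (Fin.suc j))
    ≡⟨ +-assoc c₀g₀ _ _ ⟨
  (c₀g₀ + linComb (c ∘ Fin.suc) (g ∘ Fin.suc)) + h (c (Fin.suc j)) * g (Fin.suc j) ∎
  where
  open ≡-Reasoning
  c₀g₀ = c Fin.zero * g Fin.zero

coprime-∣ˡ : ∀ {d e x} → e ∣ d → Coprime d x → Coprime e x
coprime-∣ˡ e∣d d⊥x (i∣e , i∣x) = d⊥x (∣-trans i∣e e∣d , i∣x)

coprime-*ʳ : ∀ {d x y} → Coprime d x → Coprime d y → Coprime d (x * y)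
coprime-*ʳ d⊥x d⊥y (i∣d , i∣xy) = d⊥y (i∣d , coprime-divisor (coprime-∣ˡ i∣d d⊥x) i∣xy)

coprime-^ʳ : ∀ {d x} → Coprime d x → ∀ k → Coprime d (x ^ k)
coprime-^ʳ d⊥x zero    (_ , i∣1) = ∣1⇒≡1 i∣1
coprime-^ʳ d⊥x (suc k) = coprime-*ʳ d⊥x (coprime-^ʳ d⊥x k)

¬common-factor⇒coprime : ∀ {x m} .{{_ : NonZero m}} → (∀ {d} → 1 < d → d ∣ x → d ∣ m → ⊥) → Coprime x m
¬common-factor⇒coprime {m = m} _ {zero} (_ , 0∣m) = contradiction (0∣⇒≡0 0∣m) (≢-nonZero⁻¹ m)
¬common-factor⇒coprime _ {1} _ = refl
¬common-factor⇒coprime no-factor {suc (suc _)} (d∣x , d∣m) = ⊥-elim (no-factor (s≤s (s≤s z≤n)) d∣x d∣m)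

bézout-inverse : ∀ {q d} .{{_ : NonZero d}} → Coprime q d → ∃[ s ] (s * q) % d ≡ 1 % d
bézout-inverse {q} {d@(suc d′)} q⊥d with coprime-Bézout q⊥d
... | Bézout.+- x y 1+yd≡xq = x , (begin
  (x * q) % d     ≡⟨ cong (_% d) 1+yd≡xq ⟨
  (1 + y * d) % d ≡⟨ [m+kn]%n≡m%n 1 y d ⟩
  1 % d           ∎)
  where open ≡-Reasoning
-- here x q ≡ −1, so (d − 1) x inverts q
... | Bézout.-+ x y 1+xq≡yd = d′ * x , (begin
  (d′ * x * q) % d            ≡⟨ [m+kn]%n≡m%n (d′ * x * q) 1 d ⟨
  (d′ * x * q + 1 * d) % d    ≡⟨ cong (_% d) multiple-of-1+xq ⟩
  (1 + d′ * (1 + x * q)) % d  ≡⟨ cong (λ z → (1 + d′ * z) % d) 1+xq≡yd ⟩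
  (1 + d′ * (y * d)) % d      ≡⟨ cong (λ z → (1 + z) % d) (*-assoc d′ y d) ⟨
  (1 + d′ * y * d) % d        ≡⟨ [m+kn]%n≡m%n 1 (d′ * y) d ⟩
  1 % d                       ∎)
  where
  open ≡-Reasoning
  open +-*-Solver
  multiple-of-1+xq : d′ * x * q + 1 * d ≡ 1 + d′ * (1 + x * q)
  multiple-of-1+xq = solve 3 (λ d′ x q → d′ :* x :* q :+ con 1 :* (con 1 :+ d′) := con 1 :+ d′ :* (con 1 :+ x :* q)) refl d′ x q

modular-inverse : ∀ {q d} .{{_ : NonZero d}} → 1 < d → Coprime q d → ∃[ s ] s < d × (s * q) % d ≡ 1
modular-inverse {q} {d} 1<d q⊥d with bézout-inverse q⊥d
... | s , sq≡1 = s % d , m%n<n s d , (begin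
  (s % d * q) % d              ≡⟨ %-distribˡ-* (s % d) q d ⟩
  (s % d % d * (q % d)) % d    ≡⟨ cong (λ z → (z * (q % d)) % d) (m%n%n≡m%n s d) ⟩
  (s % d * (q % d)) % d        ≡⟨ %-distribˡ-* s q d ⟨
  (s * q) % d                  ≡⟨ sq≡1 ⟩
  1 % d                        ≡⟨ m<n⇒m%n≡m 1<d ⟩
  1                            ∎)
  where open ≡-Reasoning

coefficient-≥ : ∀ {d q R u n s} → Coprime d q → d ∣ R → d ∣ n → s < d →
  R + u * q ≡ n + s * q → s ≤ u
coefficient-≥ {d} {q} {R} {u} {n} {s} d⊥q d∣R d∣n s<d R+uq≡n+sq with s ≤? u
... | yes s≤u = s≤u
... | no s≰u = contradiction (∣⇒≤ {{>-nonZero (m<n⇒0<n∸m u<s)}} d∣s∸u) (<⇒≱ (≤-<-trans (m∸n≤m s u) s<d))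
  where
  open ≡-Reasoning
  u<s : u < s
  u<s = ≰⇒> s≰u
  R≡n+[s∸u]q : R ≡ n + (s ∸ u) * q
  R≡n+[s∸u]q = +-cancelʳ-≡ (u * q) R _ (begin
    R + u * q                   ≡⟨ R+uq≡n+sq ⟩
    n + s * q                   ≡⟨ cong (λ z → n + z * q) (m∸n+n≡m (<⇒≤ u<s)) ⟨
    n + (s ∸ u + u) * q         ≡⟨ cong (n +_) (*-distribʳ-+ q (s ∸ u) u) ⟩
    n + ((s ∸ u) * q + u * q)   ≡⟨ +-assoc n _ _ ⟨
    n + (s ∸ u) * q + u * q     ∎)
  d∣s∸u : d ∣ s ∸ u
  d∣s∸u = coprime-divisor d⊥q
    (subst (d ∣_) (*-comm (s ∸ u) q) (∣m+n∣m⇒∣n (subst (d ∣_) R≡n+[s∸u]q d∣R) d∣n))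

∣n%m⇒∣n : ∀ {d m n} .{{_ : NonZero m}} → d ∣ m → d ∣ n % m → d ∣ n
∣n%m⇒∣n {d} {m} {n} d∣m d∣n%m =
  subst (d ∣_) (sym (m≡m%n+[m/n]*n n m)) (∣m∣n⇒∣m+n d∣n%m (∣n⇒∣m*n (n / m) d∣m))

-- (m′ * x + 1) % (1 + m′) is the residue class of 1 − x modulo 1 + m′.
class[1-x]+x≡1 : ∀ m′ x n → n % suc m′ ≡ (m′ * x + 1) % suc m′ → (n + x) % suc m′ ≡ 1 % suc m′
class[1-x]+x≡1 m′ x n n≡1-x = begin
  (n + x) % m                    ≡⟨ %-distribˡ-+ n x m ⟩
  (n % m + x % m) % m            ≡⟨ cong (λ z → (z + x % m) % m) n≡1-x ⟩
  ((m′ * x + 1) % m + x % m) % m ≡⟨ %-distribˡ-+ (m′ * x + 1) x m ⟨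
  (m′ * x + 1 + x) % m           ≡⟨ cong (_% m) (solve 2 (λ m′ x → m′ :* x :+ con 1 :+ x := con 1 :+ x :* (con 1 :+ m′)) refl m′ x) ⟩
  (1 + x * m) % m                ≡⟨ [m+kn]%n≡m%n 1 x m ⟩
  1 % m                          ∎
  where
  open ≡-Reasoning
  open +-*-Solver
  m = suc m′

class[1-x]-∣ : ∀ m′ {d x n} .{{_ : NonZero d}} → d ∣ suc m′ → x % d ≡ 1 →
  n % suc m′ ≡ (m′ * x + 1) % suc m′ → d ∣ n
class[1-x]-∣ m′ {d} {x} d∣m x≡1 n≡1-x =
  ∣n%m⇒∣n d∣m (subst (d ∣_) (sym n≡1-x) (%-presˡ-∣ d∣m′x+1 d∣m))
  where
  open ≡-Reasoning
  open +-*-Solver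
  t = x / d
  m′x+1≡m+m′td : m′ * x + 1 ≡ suc m′ + m′ * t * d
  m′x+1≡m+m′td = begin
    m′ * x + 1                ≡⟨ cong (λ z → m′ * z + 1) (m≡m%n+[m/n]*n x d) ⟩
    m′ * (x % d + t * d) + 1  ≡⟨ cong (λ z → m′ * (z + t * d) + 1) x≡1 ⟩
    m′ * (1 + t * d) + 1      ≡⟨ solve 3 (λ m′ t d → m′ :* (con 1 :+ t :* d) :+ con 1 := (con 1 :+ m′) :+ m′ :* t :* d) refl m′ t d ⟩
    suc m′ + m′ * t * d       ∎
  d∣m′x+1 : d ∣ m′ * x + 1
  d∣m′x+1 = subst (d ∣_) (sym m′x+1≡m+m′td) (∣m∣n⇒∣m+n d∣m (n∣m*n (m′ * t)))

module _ {N} (g : Fin N → ℕ) (j : Fin N) {d} (d∣g : ∀ i → i ≢ j → d ∣ g i) (d⊥gⱼ : Coprime d (g j)) where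

  linComb-mod : ∀ c → ∃[ R ] d ∣ R × linComb c g ≡ R + c j * g j
  linComb-mod c = linComb c₀ g , sumF-∣ _ d∣c₀g , sym (trans (linComb-updateAt c j (const 0) g) (+-identityʳ _))
    where
    c₀ = updateAt c j (const 0)
    d∣c₀g : ∀ i → d ∣ c₀ i * g i
    d∣c₀g i with i Fin.≟ j
    ... | yes refl = subst (λ v → d ∣ v * g j) (sym (updateAt-updates j c)) (d ∣0)
    ... | no i≢j   = ∣n⇒∣m*n (c₀ i) (d∣g i i≢j)

  gap-translate : ∀ {n s} → s < d → d ∣ n → ¬ n ∈⟨ g ⟩ → ¬ n + s * g j ∈⟨ g ⟩
  gap-translate {n} {s} s<d d∣n n∉ (c , n+sq≡cg) with linComb-mod c
  ... | R , d∣R , cg≡R+cⱼq = n∉ (updateAt c j (_∸ s) , n≡c′g)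
    where
    open ≡-Reasoning
    q = g j
    s≤cⱼ : s ≤ c j
    s≤cⱼ = coefficient-≥ d⊥gⱼ d∣R d∣n s<d (trans (sym cg≡R+cⱼq) (sym n+sq≡cg))
    n≡c′g : n ≡ linComb (updateAt c j (_∸ s)) g
    n≡c′g = +-cancelʳ-≡ (c j * q) n _ (begin
      n + c j * q                  ≡⟨ cong (λ u → n + u * q) (m+[n∸m]≡n s≤cⱼ) ⟨
      n + (s + (c j ∸ s)) * q      ≡⟨ cong (n +_) (*-distribʳ-+ q s (c j ∸ s)) ⟩
      n + (s * q + (c j ∸ s) * q)  ≡⟨ +-assoc n _ _ ⟨
      n + s * q + (c j ∸ s) * q    ≡⟨ cong (_+ (c j ∸ s) * q) n+sq≡cg ⟩
      linComb c g + (c j ∸ s) * q  ≡⟨ linComb-updateAt c j (_∸ s) g ⟨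
      linComb (updateAt c j (_∸ s)) g + c j * q ∎)

  1∉⟨⟩ : 1 < d → 1 < g j → ¬ 1 ∈⟨ g ⟩
  1∉⟨⟩ 1<d 1<gⱼ (c , 1≡cg) with linComb-mod c
  ... | R , d∣R , cg≡R+cⱼq = impossible (c j) (trans 1≡cg cg≡R+cⱼq)
    where
    impossible : ∀ u → 1 ≢ R + u * g j
    impossible zero    1≡R+0 = <⇒≢ 1<d (sym (∣1⇒≡1 (subst (d ∣_) (sym (trans 1≡R+0 (+-identityʳ R))) d∣R)))
    impossible (suc u) 1≡R+q+uq = <⇒≱ 1<gⱼ
      (≤-trans (m≤m+n (g j) (u * g j)) (≤-trans (m≤n+m _ R) (≤-reflexive (sym 1≡R+q+uq))))

  ¬equidistributed : ∀ m .{{_ : NonZero m}} {H} → 1 < d → 1 < g j → d ∣ m →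
    Enumerates H (λ n → ¬ n ∈⟨ g ⟩) → ¬ Equidistributed m H
  ¬equidistributed m@(suc m′) {H} 1<d 1<gⱼ d∣m (unique , enumerates) equidistributed
    with modular-inverse {{>-nonZero (<-trans z<s 1<d)}} 1<d (coprime-sym d⊥gⱼ)
  ... | s , s<d , sq≡1 =
    <⇒≢ (countMod-<-translate m unique translate 1∈H refl 1<x)
        (equidistributed r (1 % m) (m%n<n (m′ * x + 1) m) (m%n<n 1 m))
    where
    instance
      d≢0 : NonZero d
      d≢0 = >-nonZero (<-trans z<s 1<d)
    x = s * g j
    r = (m′ * x + 1) % m
    1<x : 1 < x
    1<x = 1<t*gⱼ s sq≡1
      where
      1<t*gⱼ : ∀ t → (t * g j) % d ≡ 1 → 1 < t * g j
      1<t*gⱼ zero     0%d≡1 = contradiction (trans (sym (m<n⇒m%n≡m (<-trans z<s 1<d))) 0%d≡1) (λ ())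
      1<t*gⱼ (suc t′) _     = ≤-trans 1<gⱼ (m≤m+n (g j) (t′ * g j))
    1∈H : 1 ∈ H
    1∈H = proj₂ (enumerates 1) (1∉⟨⟩ 1<d 1<gⱼ)
    translate : ∀ {n} → n ∈ H → n % m ≡ r → n + x ∈ H × (n + x) % m ≡ 1 % m
    translate {n} n∈H n≡r =
      proj₂ (enumerates (n + x)) (gap-translate s<d (class[1-x]-∣ m′ d∣m sq≡1 n≡r) (proj₁ (enumerates n) n∈H))
      , class[1-x]+x≡1 m′ x n n≡r

∣⇒∣^ : ∀ {d x e} → d ∣ x → 0 < e → d ∣ x ^ e
∣⇒∣^ {x = x} {suc e} d∣x _ = ∣m⇒∣m*n (x ^ e) d∣x

gen-last : ∀ a b k → gen a b k (fromℕ k) ≡ b ^ k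
gen-last a b k rewrite toℕ-fromℕ k | n∸n≡0 k = +-identityʳ (b ^ k)

gen-first : ∀ a b k → gen a b k Fin.zero ≡ a ^ k
gen-first a b k = *-identityʳ (a ^ k)

gen-∣ˡ : ∀ {d a} b k (i : Fin (suc k)) → d ∣ a → i ≢ fromℕ k → d ∣ gen a b k i
gen-∣ˡ b k i d∣a i≢k = ∣m⇒∣m*n (b ^ toℕ i) (∣⇒∣^ d∣a (m<n⇒0<n∸m (≤∧≢⇒< (toℕ≤pred[n] i) toℕi≢k)))
  where
  toℕi≢k : toℕ i ≢ k
  toℕi≢k toℕi≡k = i≢k (toℕ-injective (trans toℕi≡k (sym (toℕ-fromℕ k))))

gen-∣ʳ : ∀ {d b} a k (i : Fin (suc k)) → d ∣ b → i ≢ Fin.zero → d ∣ gen a b k i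
gen-∣ʳ a k Fin.zero    d∣b i≢0 = contradiction refl i≢0
gen-∣ʳ {b = b} a k (Fin.suc i) d∣b _ = ∣n⇒∣m*n (a ^ (k ∸ suc (toℕ i))) (∣m⇒∣m*n (b ^ toℕ i) d∣b)

mainTheorem2 : (a b k m : ℕ) → .{{_ : NonZero m}} → 1 < a → 1 < b → 0 < k →
    gcd a b ≡ 1 →
    (H : List ℕ) → Enumerates H (Gap a b k) →
    Equidistributed m H →
    gcd (a * b) m ≡ 1
mainTheorem2 a b k m 1<a 1<b 0<k gcd[a,b]≡1 H enumerates equidistributed =
  coprime⇒gcd≡1 (coprime-sym (coprime-*ʳ (coprime-sym a⊥m) (coprime-sym b⊥m)))
  where
  a⊥b : Coprime a b
  a⊥b = gcd≡1⇒coprime gcd[a,b]≡1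
  a⊥m : Coprime a m
  a⊥m = ¬common-factor⇒coprime λ 1<d d∣a d∣m →
    ¬equidistributed (gen a b k) (fromℕ k) (λ i → gen-∣ˡ b k i d∣a)
      (subst (Coprime _) (sym (gen-last a b k)) (coprime-^ʳ (coprime-∣ˡ d∣a a⊥b) k))
      m 1<d (subst (1 <_) (sym (gen-last a b k)) (^-monoʳ-< b 1<b 0<k)) d∣m enumerates equidistributed
  b⊥m : Coprime b m
  b⊥m = ¬common-factor⇒coprime λ 1<d d∣b d∣m →
    ¬equidistributed (gen a b k) Fin.zero (λ i → gen-∣ʳ a k i d∣b)
      (subst (Coprime _) (sym (gen-first a b k)) (coprime-^ʳ (coprime-∣ˡ d∣b (coprime-sym a⊥b)) k))
      m 1<d (subst (1 <_) (sym (gen-first a b k)) (^-monoʳ-< a 1<a 0<k)) d∣m enumerates equidistributed
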